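{- Let $G$ be a finite abelian group. Then $\mathsf{g}_{\pm}(G)=|G|+1$ if and only if $G$ is an elementary $2$-group or a cyclic group of order congruent to $2$ modulo $4$.
   Context: For a finite abelian group $G$ (written additively), $\exp(G)$ denotes its exponent. The plus-minus weighted Harborth constant $\mathsf{g}_{\pm}(G)$ is the smallest $\ell\in\mathbb{N}$ such that for every subset $S\subseteq G$ with $|S|\ge\ell$ there exist $\exp(G)$ distinct elements $g_1,\dots,g_{\exp(G)}\in S$ and signs $\varepsilon_i\in\{+1,-1\}$ with $\sum_i\varepsilon_ig_i=0$. (If no subset of $G$ has cardinality $\ell$, the condition is vacuously satisfied.) -}

module Defs where

open import Data.Nat using (ℕ; zero; suc; _≤_; _<_; _%_)
open import Data.Fin using (Fin)
open import Data.Bool using (Bool; true; false)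
open import Data.Product using (Σ; ∃; _×_; _,_; proj₂)
open import Data.Sum using (_⊎_)
open import Data.List using (List; []; _∷_; length; map)
open import Data.List.Relation.Unary.All using (All)
open import Data.List.Relation.Unary.Unique.Propositional using (Unique)
open import Data.List.Membership.Propositional using (_∈_)
open import Relation.Nullary using (¬_)
open import Relation.Binary.PropositionalEquality using (_≡_)
open import Algebra.Structures using (IsAbelianGroup)
open import Function.Bundles using (_↔_)

record FiniteAbelianGroup : Set₁ where
  field
    Carrier        : Set
    _+_            : Carrier → Carrier → Carrier
    0#             : Carrier
    -_             : Carrier → Carrier
    isAbelianGroup : IsAbelianGroup _≡_ _+_ 0# -_
    order          : ℕ
    enum           : Fin order ↔ Carrier

module _ (G : FiniteAbelianGroup) where
  open FiniteAbelianGroup G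

  _·_ : ℕ → Carrier → Carrier
  zero  · g = 0#
  suc k · g = g + (k · g)

  IsExponent : ℕ → Set
  IsExponent e = (1 ≤ e) × (∀ g → e · g ≡ 0#)
               × (∀ m → 1 ≤ m → m < e → ¬ (∀ g → m · g ≡ 0#))

  -- signed sum  Σ ε_i g_i  of a list of (sign, element); true = +1, false = -1
  signedSum : List (Bool × Carrier) → Carrier
  signedSum []                 = 0#
  signedSum ((true  , g) ∷ ts) = g + signedSum ts
  signedSum ((false , g) ∷ ts) = (- g) + signedSum ts

  -- S (a set of elements, given as a duplicate-free list) contains e distinct
  -- elements g_1..g_e with signs ε_i such that Σ ε_i g_i = 0
  HasPMZeroSum : ℕ → List Carrier → Set
  HasPMZeroSum e S = Σ (List (Bool × Carrier)) λ ts →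
      (length ts ≡ e) × Unique (map proj₂ ts)
    × All (λ g → g ∈ S) (map proj₂ ts) × (signedSum ts ≡ 0#)

  PMProperty : ℕ → ℕ → Set
  PMProperty e ℓ = ∀ (S : List Carrier) → Unique S → ℓ ≤ length S → HasPMZeroSum e S

  IsPMHarborth : ℕ → ℕ → Set
  IsPMHarborth e ℓ = PMProperty e ℓ × (∀ m → m < ℓ → ¬ PMProperty e m)

  IsElementary2Group : Set
  IsElementary2Group = IsExponent 2

  IsCyclic : Set
  IsCyclic = ∃ λ g → ∀ h → ∃ λ k → k · g ≡ h

  IsCyclic2mod4 : Set
  IsCyclic2mod4 = IsCyclic × (order % 4 ≡ 2)

-- A set of size |G| is G itself, so g±(G) = |G| + 1 exactly when G has no e = exp(G)
-- distinct elements with a ± zero sum.  Orders of elements are closed under lcm, so some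
-- g has order e.  If e is odd, 0, g, …, (e − 1)g sum to e(e − 1)/2 · g = 0; if 4 ∣ e,
-- the same works after flipping the sign of (e/4)g.  If e ≡ 2 mod 4 and e > 2, drop 0 and
-- (e/2)g and add x, −x for some x ∉ ⟨g⟩ with 2x ≠ 0 (h or h + g for any h ∉ ⟨g⟩), which
-- exists unless G = ⟨g⟩ is cyclic.  Conversely, in an elementary 2-group ±a ± b = a + b ≠ 0
-- for a ≠ b; and in a cyclic group of order e ≡ 2 mod 4, e distinct elements are all of G,
-- e/2 of them of odd index, so every signed sum of them has odd index and is not 0.

module Submission where

open import Defs
open import Data.Nat using (ℕ; suc)
open import Data.Sum using (_⊎_)
open import Data.Product using (_×_)

open import Data.Nat using (zero; _+_; _*_; _∸_; _≤_; _<_; _%_; _/_; z≤n; s≤s; z<s; s≤s⁻¹;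
  NonZero; ≢-nonZero; ≢-nonZero⁻¹; >-nonZero; >-nonZero⁻¹; NonTrivial; n>1⇒nonTrivial)
open import Data.Nat.Properties
open import Data.Nat.DivMod
  using (m/n*n≡m; m≡m%n+[m/n]*n; m%n<n; %-distribˡ-+; m%n%n≡m%n; m∣n⇒o%n%m≡o%m; [m+kn]%n≡m%n)
open import Data.Nat.Tactic.RingSolver using (solve-∀)
open import Data.Nat.Divisibility
open import Data.Nat.Coprimality using (Coprime; coprime-divisor; gcd≡1⇒coprime; coprime-/gcd; 1-coprimeTo)
  renaming (sym to coprime-sym)
open import Data.Nat.GCD using (gcd; gcd[m,n]∣m; gcd[m,n]∣n; gcd[m,n]≢0)
open import Data.Nat.Induction using (<-wellFounded)
open import Induction.WellFounded using (Acc; acc)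
open import Data.Product using (∃; ∃₂; _,_; proj₁; proj₂)
open import Data.Sum using (inj₁; inj₂)
open import Relation.Nullary using (¬_; Dec; yes; no; contradiction; ¬?)
open import Relation.Binary.Definitions using (DecidableEquality; tri<; tri≈; tri>)
open import Relation.Binary.PropositionalEquality
open import Level using (0ℓ)
open import Data.Bool using (Bool; true; false)
open import Algebra.Bundles using (AbelianGroup)
open import Algebra.Structures using (IsAbelianGroup)
import Algebra.Properties.Group as GroupProperties
import Algebra.Properties.CommutativeSemigroup as CommutativeSemigroupProperties
open import Data.Fin using () renaming (_≟_ to _≟ᶠ_)
open import Function.Bundles using (Inverse; Injection; Equivalence; _⇔_; mk⇔)
open import Function.Properties.Inverse using (↔⇒↣; ↔-sym)
open import Relation.Nullary.Decidable using (via-injection; map′)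
open import Data.List using (List; []; _∷_; _++_; length; iterate; map; filter; allFin)
open import Data.List.Properties using (length-iterate; length-++; length-map; length-tabulate;
  filter-notAll; filter-accept; filter-reject; map-∘; map-id)
open import Data.Nat.ListAction using (sum)
open import Data.Nat.ListAction.Properties using (sum-++)
open import Data.List.Membership.Propositional using (_∈_)
open import Data.List.Membership.Propositional.Properties
  using (∈-++⁻; ∈-filter⁺; ∈-filter⁻; ∈-map⁺; ∈-map⁻; ∈-allFin)
open import Data.List.Relation.Unary.Any as Any using (here; there)
open import Data.List.Relation.Binary.Subset.Propositional using (_⊆_)
open import Data.List.Relation.Unary.All as All using (All; []; _∷_; all?)
import Data.List.Relation.Unary.All.Properties as All
open import Data.List.Relation.Unary.AllPairs using ([]; _∷_)
open import Data.List.Relation.Unary.Unique.Propositional using (Unique)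
import Data.List.Relation.Unary.Unique.Propositional.Properties as Unique
open import Function using (_∘_; id; case_of_)

-- Coprime factorisations and other arithmetic

coprime-*ˡ : ∀ {a b c} → Coprime a c → Coprime b c → Coprime (a * b) c
coprime-*ˡ {a} {b} {c} a⊥c b⊥c {i} (i∣ab , i∣c) = b⊥c (coprime-divisor i⊥a i∣ab , i∣c)
  where
  i⊥a : Coprime i a
  i⊥a (j∣i , j∣a) = a⊥c (j∣a , ∣-trans j∣i i∣c)

coprime-*ʳ : ∀ {a b c} → Coprime a b → Coprime a c → Coprime a (b * c)
coprime-*ʳ a⊥b a⊥c = coprime-sym (coprime-*ˡ (coprime-sym a⊥b) (coprime-sym a⊥c))

coprime-∣ʳ : ∀ {a b c} → Coprime a b → c ∣ b → Coprime a c
coprime-∣ʳ a⊥b c∣b (i∣a , i∣c) = a⊥b (i∣a , ∣-trans i∣c c∣b)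

coprime⇒*∣ : ∀ {m n k} → Coprime m n → m ∣ k → n ∣ k → m * n ∣ k
coprime⇒*∣ {m} {n} m⊥n (divides q refl) n∣qm =
  subst (_∣ q * m) (*-comm n m) (*-monoˡ-∣ m (coprime-divisor (coprime-sym m⊥n) n∣mq))
  where
  n∣mq : n ∣ m * q
  n∣mq = subst (n ∣_) (*-comm q m) n∣qm

-- Every prime factor of r divides n, phrased without primes.
Smooth : ℕ → ℕ → Set
Smooth r n = ∀ {t} → Coprime t n → Coprime t r

coprime-smooth-split : ∀ n g .{{_ : NonZero g}} →
  ∃₂ λ s r → g ≡ s * r × Coprime s n × Smooth r n
coprime-smooth-split n g = split g (<-wellFounded g)
  where
  split : ∀ g .{{_ : NonZero g}} → Acc _<_ g → ∃₂ λ s r → g ≡ s * r × Coprime s n × Smooth r n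
  split g (acc rec) with gcd g n ≟ 1
  ... | yes g⊥n = g , 1 , sym (*-identityʳ g) , gcd≡1⇒coprime g⊥n , λ _ → coprime-sym (1-coprimeTo _)
  ... | no d≢1 = extend (split g′ (rec (quotient-< d∣g)))
    where
    d∣g = gcd[m,n]∣m g n
    g′ = quotient d∣g
    instance
      g′≢0 : NonZero g′
      g′≢0 = quotient≢0 d∣g
      d-nonTrivial : NonTrivial (gcd g n)
      d-nonTrivial = n>1⇒nonTrivial (≤∧≢⇒< (n≢0⇒n>0 (gcd[m,n]≢0 g n (inj₁ (≢-nonZero⁻¹ g)))) (d≢1 ∘ sym))
    extend : (∃₂ λ s r → g′ ≡ s * r × Coprime s n × Smooth r n) →
             ∃₂ λ s r → g ≡ s * r × Coprime s n × Smooth r n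
    extend (s , r , g′≡sr , s⊥n , r-smooth) = s , gcd g n * r , g≡sdr , s⊥n ,
      λ t⊥n → coprime-*ʳ (coprime-∣ʳ t⊥n (gcd[m,n]∣n g n)) (r-smooth t⊥n)
      where
      open ≡-Reasoning
      g≡sdr : g ≡ s * (gcd g n * r)
      g≡sdr = begin
        g                  ≡⟨ m∣n⇒n≡quotient*m d∣g ⟩
        g′ * gcd g n       ≡⟨ cong (_* gcd g n) g′≡sr ⟩
        s * r * gcd g n    ≡⟨ *-assoc s r (gcd g n) ⟩
        s * (r * gcd g n)  ≡⟨ cong (s *_) (*-comm r (gcd g n)) ⟩
        s * (gcd g n * r)  ∎

-- m′ n′ = lcm(m, n), split into coprime factors of m and of n
coprime-lcm-factors : ∀ m n .{{_ : NonZero m}} →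
  ∃₂ λ m′ n′ → m′ ∣ m × n′ ∣ n × Coprime m′ n′ × m ∣ m′ * n′ × n ∣ m′ * n′
coprime-lcm-factors m n = combine (coprime-smooth-split n₁ d)
  where
  d = gcd m n
  instance
    d≢0 : NonZero d
    d≢0 = ≢-nonZero (gcd[m,n]≢0 m n (inj₁ (≢-nonZero⁻¹ m)))
  m₁ = m / d
  n₁ = n / d
  m₁⊥n₁ : Coprime m₁ n₁
  m₁⊥n₁ = coprime-/gcd m n
  combine : (∃₂ λ s r → d ≡ s * r × Coprime s n₁ × Smooth r n₁) →
    ∃₂ λ m′ n′ → m′ ∣ m × n′ ∣ n × Coprime m′ n′ × m ∣ m′ * n′ × n ∣ m′ * n′
  combine (s , r , d≡sr , s⊥n₁ , r-smooth) =
    m₁ * s , n₁ * r ,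
    subst (m₁ * s ∣_) (sym m≡m₁sr) (∣m⇒∣m*n r ∣-refl) ,
    subst (n₁ * r ∣_) (sym n≡n₁rs) (∣m⇒∣m*n s ∣-refl) ,
    coprime-*ˡ (coprime-*ʳ m₁⊥n₁ (r-smooth m₁⊥n₁)) (coprime-*ʳ s⊥n₁ (r-smooth s⊥n₁)) ,
    divides n₁ (trans (rearrangeₘ m₁ s n₁ r) (cong (n₁ *_) (sym m≡m₁sr))) ,
    divides m₁ (trans (rearrangeₙ m₁ s n₁ r) (cong (m₁ *_) (sym n≡n₁rs)))
    where
    m≡m₁sr : m ≡ m₁ * s * r
    m≡m₁sr = trans (sym (m/n*n≡m (gcd[m,n]∣m m n))) (trans (cong (m₁ *_) d≡sr) (sym (*-assoc m₁ s r)))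
    n≡n₁rs : n ≡ n₁ * r * s
    n≡n₁rs = trans (sym (m/n*n≡m (gcd[m,n]∣n m n)))
                   (trans (cong (n₁ *_) (trans d≡sr (*-comm s r))) (sym (*-assoc n₁ r s)))
    rearrangeₘ : ∀ m₁ s n₁ r → m₁ * s * (n₁ * r) ≡ n₁ * (m₁ * s * r)
    rearrangeₘ = solve-∀
    rearrangeₙ : ∀ m₁ s n₁ r → m₁ * s * (n₁ * r) ≡ m₁ * (n₁ * r * s)
    rearrangeₙ = solve-∀

least-positive-or-none : {P : ℕ → Set} → (∀ k → Dec (P k)) → ∀ N →
    (∃ λ m → 0 < m × P m × (∀ {k} → 0 < k → k < m → ¬ P k))
  ⊎ (∀ {k} → 0 < k → k ≤ N → ¬ P k)
least-positive-or-none P? zero = inj₂ λ 0<k k≤0 → contradiction k≤0 (<⇒≱ 0<k)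
least-positive-or-none P? (suc N) with least-positive-or-none P? N
... | inj₁ least = inj₁ least
... | inj₂ none-≤N with P? (suc N)
...   | yes P[1+N] = inj₁ (suc N , z<s , P[1+N] , λ 0<k k<1+N → none-≤N 0<k (s≤s⁻¹ k<1+N))
...   | no ¬P[1+N] = inj₂ λ 0<k k≤1+N → case m≤n⇒m<n∨m≡n k≤1+N of λ
  { (inj₁ k<1+N) → none-≤N 0<k (s≤s⁻¹ k<1+N)
  ; (inj₂ refl)  → ¬P[1+N] }

[m+n%d]%d≡[m+n]%d : ∀ m n d .{{_ : NonZero d}} → (m + n % d) % d ≡ (m + n) % d
[m+n%d]%d≡[m+n]%d m n d = begin
  (m + n % d) % d          ≡⟨ %-distribˡ-+ m (n % d) d ⟩
  (m % d + n % d % d) % d  ≡⟨ cong (λ r → (m % d + r) % d) (m%n%n≡m%n n d) ⟩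
  (m % d + n % d) % d      ≡⟨ %-distribˡ-+ m n d ⟨
  (m + n) % d              ∎
  where open ≡-Reasoning

bits-even-sum⇒≡ : ∀ {a b} → a ≤ 1 → b ≤ 1 → (a + b) % 2 ≡ 0 → a ≡ b
bits-even-sum⇒≡ z≤n       z≤n       _ = refl
bits-even-sum⇒≡ z≤n       (s≤s z≤n) ()
bits-even-sum⇒≡ (s≤s z≤n) z≤n       ()
bits-even-sum⇒≡ (s≤s z≤n) (s≤s z≤n) _ = refl

bit≢1⇒≡0 : ∀ {a} → a ≤ 1 → a ≢ 1 → a ≡ 0
bit≢1⇒≡0 z≤n       _   = refl
bit≢1⇒≡0 (s≤s z≤n) a≢1 = contradiction refl a≢1

-- Lists: pigeonhole, counting, intervals

unique∧⊆⇒length≤ : {A : Set} → DecidableEquality A →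
  {xs ys : List A} → Unique xs → xs ⊆ ys → length xs ≤ length ys
unique∧⊆⇒length≤ _≟_ {[]} _ _ = z≤n
unique∧⊆⇒length≤ _≟_ {x ∷ xs} {ys} (x∉xs ∷ xs-unique) x∷xs⊆ys = begin-strict
  length xs                    ≤⟨ unique∧⊆⇒length≤ _≟_ xs-unique xs⊆ys∖x ⟩
  length (filter ≢x? ys)       <⟨ filter-notAll ≢x? ys (Any.map (contradiction ∘ sym) (x∷xs⊆ys (here refl))) ⟩
  length ys                    ∎
  where
  open ≤-Reasoning
  ≢x? = λ y → ¬? (y ≟ x)
  xs⊆ys∖x : xs ⊆ filter ≢x? ys
  xs⊆ys∖x z∈xs = ∈-filter⁺ ≢x? (x∷xs⊆ys (there z∈xs)) λ { refl → All.lookup x∉xs z∈xs refl }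

module _ {A : Set} where

  length-filter-+-∁ : {P : A → Set} (P? : ∀ x → Dec (P x)) → ∀ xs →
    length (filter P? xs) + length (filter (¬? ∘ P?) xs) ≡ length xs
  length-filter-+-∁ P? [] = refl
  length-filter-+-∁ P? (x ∷ xs) with P? x
  ... | yes _ = cong suc (length-filter-+-∁ P? xs)
  ... | no  _ = trans (+-suc _ _) (cong suc (length-filter-+-∁ P? xs))

  sum-bits : (f : A → ℕ) → (∀ x → f x ≤ 1) → ∀ xs → sum (map f xs) ≡ length (filter (λ x → f x ≟ 1) xs)
  sum-bits f f≤1 [] = refl
  sum-bits f f≤1 (x ∷ xs) with f x ≟ 1
  ... | yes fx≡1 = trans (cong₂ _+_ fx≡1 (sum-bits f f≤1 xs))
                         (cong length (sym (filter-accept (λ y → f y ≟ 1) fx≡1)))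
  ... | no  fx≢1 = trans (cong₂ _+_ (bit≢1⇒≡0 (f≤1 x) fx≢1) (sum-bits f f≤1 xs))
                         (cong length (sym (filter-reject (λ y → f y ≟ 1) fx≢1)))

interval : ℕ → ℕ → List ℕ
interval = iterate suc

∈-interval⁻ : ∀ {x} a n → x ∈ interval a n → a ≤ x × x < a + n
∈-interval⁻ a (suc n) (here refl) = ≤-refl , m<m+n a z<s
∈-interval⁻ {x} a (suc n) (there x∈) with a<x , x<1+a+n ← ∈-interval⁻ (suc a) n x∈ =
  <⇒≤ a<x , subst (x <_) (sym (+-suc a n)) x<1+a+n

∈-interval⁺ : ∀ {x} a n → a ≤ x → x < a + n → x ∈ interval a n
∈-interval⁺ {x} a zero a≤x x<a+0 = contradiction (subst (x <_) (+-identityʳ a) x<a+0) (≤⇒≯ a≤x)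
∈-interval⁺ {x} a (suc n) a≤x x<a+1+n with a ≟ x
... | yes refl = here refl
... | no a≢x = there (∈-interval⁺ (suc a) n (≤∧≢⇒< a≤x a≢x) (subst (x <_) (+-suc a n) x<a+1+n))

interval-unique : ∀ a n → Unique (interval a n)
interval-unique a zero = []
interval-unique a (suc n) =
  All.tabulate (λ x∈ → <⇒≢ (proj₁ (∈-interval⁻ (suc a) n x∈))) ∷ interval-unique (suc a) n

sum-interval : ∀ a n → 2 * sum (interval a n) + n ≡ n * (2 * a + n)
sum-interval a zero = *-zeroʳ (2 * 0)
sum-interval a (suc n) = begin
  2 * (a + S) + suc n                ≡⟨ regroup a S n ⟩
  (2 * S + n) + (2 * a + 1)          ≡⟨ cong (_+ (2 * a + 1)) (sum-interval (suc a) n) ⟩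
  n * (2 * suc a + n) + (2 * a + 1)  ≡⟨ expand a n ⟩
  suc n * (2 * a + suc n)            ∎
  where
  open ≡-Reasoning
  S = sum (interval (suc a) n)
  regroup : ∀ a S n → 2 * (a + S) + suc n ≡ (2 * S + n) + (2 * a + 1)
  regroup = solve-∀
  expand : ∀ a n → n * (2 * suc a + n) + (2 * a + 1) ≡ suc n * (2 * a + suc n)
  expand = solve-∀

punctured : ℕ → ℕ → ℕ → List ℕ
punctured a m n = interval a m ++ interval (suc (a + m)) n

∈-punctured⁻ : ∀ {x} a m n → x ∈ punctured a m n → x < a + m + suc n × x ≢ a + m
∈-punctured⁻ {x} a m n x∈ with ∈-++⁻ (interval a m) x∈
... | inj₁ x∈ˡ = <-≤-trans x<a+m (m≤m+n (a + m) (suc n)) , <⇒≢ x<a+m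
  where x<a+m = proj₂ (∈-interval⁻ a m x∈ˡ)
... | inj₂ x∈ʳ with a+m<x , x<1+a+m+n ← ∈-interval⁻ (suc (a + m)) n x∈ʳ =
  subst (x <_) (sym (+-suc (a + m) n)) x<1+a+m+n , >⇒≢ a+m<x

interval-< : ∀ a n → All (_< a + n) (interval a n)
interval-< a n = All.tabulate (proj₂ ∘ ∈-interval⁻ a n)

punctured-unique : ∀ a m n → Unique (punctured a m n)
punctured-unique a m n = Unique.++⁺ (interval-unique a m) (interval-unique (suc (a + m)) n)
  λ (x∈ˡ , x∈ʳ) → <⇒≱ (proj₂ (∈-interval⁻ a m x∈ˡ)) (<⇒≤ (proj₁ (∈-interval⁻ (suc (a + m)) n x∈ʳ)))

length-punctured : ∀ a m n → length (punctured a m n) ≡ m + n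
length-punctured a m n =
  trans (length-++ (interval a m)) (cong₂ _+_ (length-iterate suc a m) (length-iterate suc (suc (a + m)) n))

sum-punctured : ∀ a m n →
  2 * sum (punctured a m n) + (m + n) ≡ m * (2 * a + m) + n * (2 * suc (a + m) + n)
sum-punctured a m n = begin
  2 * sum (interval a m ++ I) + (m + n)  ≡⟨ cong (λ t → 2 * t + (m + n)) (sum-++ (interval a m) I) ⟩
  2 * (Sˡ + Sʳ) + (m + n)                ≡⟨ regroup Sˡ Sʳ m n ⟩
  (2 * Sˡ + m) + (2 * Sʳ + n)            ≡⟨ cong₂ _+_ (sum-interval a m) (sum-interval (suc (a + m)) n) ⟩
  m * (2 * a + m) + n * (2 * suc (a + m) + n) ∎
  where
  open ≡-Reasoning
  I = interval (suc (a + m)) n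
  Sˡ = sum (interval a m)
  Sʳ = sum I
  regroup : ∀ Sˡ Sʳ m n → 2 * (Sˡ + Sʳ) + (m + n) ≡ (2 * Sˡ + m) + (2 * Sʳ + n)
  regroup = solve-∀

-- Residues modulo 4 and the index sums of the zero-sum constructions

data Mod4View : ℕ → Set where
  odd   : ∀ q → Mod4View (1 + q * 2)
  0mod4 : ∀ q → Mod4View (q * 4)
  2mod4 : ∀ q → Mod4View (2 + q * 4)

mod4-view : ∀ n → Mod4View n
mod4-view 0 = 0mod4 0
mod4-view 1 = odd 0
mod4-view 2 = 2mod4 0
mod4-view 3 = odd 1
mod4-view (suc (suc (suc (suc n)))) with mod4-view n
... | odd q   = odd (2 + q)
... | 0mod4 q = 0mod4 (suc q)
... | 2mod4 q = 2mod4 (suc q)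

double-cancel : ∀ {x y} c → 2 * x + c ≡ 2 * y + c → x ≡ y
double-cancel {x} {y} c eq = *-cancelˡ-≡ x y 2 (+-cancelʳ-≡ c (2 * x) (2 * y) eq)

sum-interval-odd : ∀ q → sum (interval 0 (1 + q * 2)) ≡ q * (1 + q * 2)
sum-interval-odd q = double-cancel (1 + q * 2) (trans (sum-interval 0 (1 + q * 2)) (expand q))
  where
  expand : ∀ q → (1 + q * 2) * (2 * 0 + (1 + q * 2)) ≡ 2 * (q * (1 + q * 2)) + (1 + q * 2)
  expand = solve-∀

sum-punctured-0mod4 : ∀ q → sum (punctured 0 (suc q) (2 + 3 * q)) ≡ suc q + (1 + 2 * q) * (suc q * 4)
sum-punctured-0mod4 q =
  double-cancel (suc q + (2 + 3 * q)) (trans (sum-punctured 0 (suc q) (2 + 3 * q)) (expand q))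
  where
  expand : ∀ q → suc q * (2 * 0 + suc q) + (2 + 3 * q) * (2 * suc (suc q) + (2 + 3 * q))
               ≡ 2 * (suc q + (1 + 2 * q) * (suc q * 4)) + (suc q + (2 + 3 * q))
  expand = solve-∀

sum-punctured-2mod4 : ∀ q → sum (punctured 1 (2 + 2 * q) (2 + 2 * q)) ≡ (2 + 2 * q) * (2 + suc q * 4)
sum-punctured-2mod4 q =
  double-cancel ((2 + 2 * q) + (2 + 2 * q)) (trans (sum-punctured 1 (2 + 2 * q) (2 + 2 * q)) (expand q))
  where
  expand : ∀ q → (2 + 2 * q) * (2 * 1 + (2 + 2 * q)) + (2 + 2 * q) * (2 * suc (1 + (2 + 2 * q)) + (2 + 2 * q))
               ≡ 2 * ((2 + 2 * q) * (2 + suc q * 4)) + ((2 + 2 * q) + (2 + 2 * q))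
  expand = solve-∀

-- Finite abelian groups

module _ (G : FiniteAbelianGroup) where

  open FiniteAbelianGroup G using (Carrier; 0#; order; enum; isAbelianGroup)
    renaming (_+_ to infixl 6 _⊕_; -_ to infix 8 ⊖_)
  open IsAbelianGroup isAbelianGroup using (assoc; comm; identityˡ; identityʳ; inverseˡ; inverseʳ)

  private
    abelianGroup : AbelianGroup 0ℓ 0ℓ
    abelianGroup = record { isAbelianGroup = isAbelianGroup }

  open GroupProperties (AbelianGroup.group abelianGroup) using (∙-cancelˡ; inverseʳ-unique; ⁻¹-involutive)
  open CommutativeSemigroupProperties (AbelianGroup.commutativeSemigroup abelianGroup) using (interchange)

  infixr 8 _⋆_
  _⋆_ : ℕ → Carrier → Carrier
  _⋆_ = _·_ G

  ⋆-homo-+ : ∀ m n x → (m + n) ⋆ x ≡ m ⋆ x ⊕ n ⋆ x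
  ⋆-homo-+ zero    n x = sym (identityˡ (n ⋆ x))
  ⋆-homo-+ (suc m) n x = trans (cong (x ⊕_) (⋆-homo-+ m n x)) (sym (assoc x (m ⋆ x) (n ⋆ x)))

  ⋆-homo-* : ∀ m n x → (m * n) ⋆ x ≡ m ⋆ n ⋆ x
  ⋆-homo-* zero    n x = refl
  ⋆-homo-* (suc m) n x = trans (⋆-homo-+ n (m * n) x) (cong (n ⋆ x ⊕_) (⋆-homo-* m n x))

  ⋆-comm : ∀ m n x → m ⋆ n ⋆ x ≡ n ⋆ m ⋆ x
  ⋆-comm m n x = trans (sym (⋆-homo-* m n x)) (trans (cong (_⋆ x) (*-comm m n)) (⋆-homo-* n m x))

  ⋆-zeroʳ : ∀ k → k ⋆ 0# ≡ 0#
  ⋆-zeroʳ zero    = refl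
  ⋆-zeroʳ (suc k) = trans (identityˡ (k ⋆ 0#)) (⋆-zeroʳ k)

  ⋆-distrib-⊕ : ∀ k x y → k ⋆ (x ⊕ y) ≡ k ⋆ x ⊕ k ⋆ y
  ⋆-distrib-⊕ zero    x y = sym (identityˡ 0#)
  ⋆-distrib-⊕ (suc k) x y = trans (cong (x ⊕ y ⊕_) (⋆-distrib-⊕ k x y)) (interchange x y (k ⋆ x) (k ⋆ y))

  ⋆-annihilates : ∀ {n x} k → n ⋆ x ≡ 0# → n ⋆ k ⋆ x ≡ 0#
  ⋆-annihilates {n} {x} k n⋆x≡0 = trans (⋆-comm n k x) (trans (cong (k ⋆_) n⋆x≡0) (⋆-zeroʳ k))

  ∣-annihilates : ∀ {m k x} → m ⋆ x ≡ 0# → m ∣ k → k ⋆ x ≡ 0#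
  ∣-annihilates {m} {x = x} m⋆x≡0 (divides q refl) =
    trans (⋆-homo-* q m x) (trans (cong (q ⋆_) m⋆x≡0) (⋆-zeroʳ q))

  ⋆-+-multiple : ∀ {m x} → m ⋆ x ≡ 0# → ∀ k c → (k + c * m) ⋆ x ≡ k ⋆ x
  ⋆-+-multiple {m} {x} m⋆x≡0 k c = begin
    (k + c * m) ⋆ x      ≡⟨ ⋆-homo-+ k (c * m) x ⟩
    k ⋆ x ⊕ (c * m) ⋆ x  ≡⟨ cong (k ⋆ x ⊕_) (∣-annihilates m⋆x≡0 (n∣m*n c)) ⟩
    k ⋆ x ⊕ 0#           ≡⟨ identityʳ (k ⋆ x) ⟩
    k ⋆ x                ∎
    where open ≡-Reasoning

  ⋆-% : ∀ {m x} .{{_ : NonZero m}} → m ⋆ x ≡ 0# → ∀ k → k ⋆ x ≡ (k % m) ⋆ x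
  ⋆-% {m} {x} m⋆x≡0 k =
    trans (cong (_⋆ x) (m≡m%n+[m/n]*n k m)) (⋆-+-multiple m⋆x≡0 (k % m) (k / m))

  exponent-unique : ∀ {m n} → IsExponent G m → IsExponent G n → m ≡ n
  exponent-unique {m} {n} (0<m , m-ann , m-min) (0<n , n-ann , n-min) with <-cmp m n
  ... | tri< m<n _ _ = contradiction m-ann (n-min _ 0<m m<n)
  ... | tri≈ _ m≡n _ = m≡n
  ... | tri> _ _ n<m = contradiction n-ann (m-min _ 0<n n<m)

  infix 4 _≟ᴳ_
  _≟ᴳ_ : DecidableEquality Carrier
  _≟ᴳ_ = via-injection (↔⇒↣ (↔-sym enum)) _≟ᶠ_

  open import Data.List.Membership.DecPropositional _≟ᴳ_ using (_∈?_)

  elements : List Carrier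
  elements = map (Inverse.to enum) (allFin order)

  ∈-elements : ∀ x → x ∈ elements
  ∈-elements x = subst (_∈ elements) (Inverse.strictlyInverseˡ enum x) (∈-map⁺ (Inverse.to enum) (∈-allFin _))

  elements-unique : Unique elements
  elements-unique = Unique.map⁺ (Injection.injective (↔⇒↣ enum)) (Unique.allFin⁺ order)

  length-elements : length elements ≡ order
  length-elements = trans (length-map (Inverse.to enum) (allFin order)) (length-tabulate {n = order} (λ i → i))

  unique⇒length≤order : ∀ {xs} → Unique xs → length xs ≤ order
  unique⇒length≤order xs-unique =
    subst (_ ≤_) length-elements (unique∧⊆⇒length≤ _≟ᴳ_ xs-unique (λ {x} _ → ∈-elements x))

  unique∧order≤length⇒∈ : ∀ {xs} → Unique xs → order ≤ length xs → ∀ x → x ∈ xs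
  unique∧order≤length⇒∈ {xs} xs-unique order≤length x with x ∈? xs
  ... | yes x∈xs = x∈xs
  ... | no  x∉xs = contradiction (unique⇒length≤order x∷xs-unique) (≤⇒≯ order≤length)
    where
    x∷xs-unique : Unique (x ∷ xs)
    x∷xs-unique = All.tabulate (λ y∈xs x≡y → x∉xs (subst (_∈ xs) (sym x≡y) y∈xs)) ∷ xs-unique

  zero-sum-⊆ : ∀ {e xs ys} → xs ⊆ ys → HasPMZeroSum G e xs → HasPMZeroSum G e ys
  zero-sum-⊆ xs⊆ys (ts , length≡e , distinct , ts⊆xs , sum≡0) =
    ts , length≡e , distinct , All.map xs⊆ys ts⊆xs , sum≡0

  distinct-zero-sum : ∀ {e} ts → length ts ≡ e → Unique (map proj₂ ts) → signedSum G ts ≡ 0# →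
    HasPMZeroSum G e elements
  distinct-zero-sum ts length≡e distinct sum≡0 =
    ts , length≡e , distinct , All.tabulate (λ {x} _ → ∈-elements x) , sum≡0

  positives : List Carrier → List (Bool × Carrier)
  positives = map (true ,_)

  proj₂-positives : ∀ xs → map proj₂ (positives xs) ≡ xs
  proj₂-positives xs = trans (sym (map-∘ xs)) (map-id xs)

  length-positives : ∀ xs → length (positives xs) ≡ length xs
  length-positives = length-map (true ,_)

  length-positive-multiples : ∀ g ks → length (positives (map (_⋆ g) ks)) ≡ length ks
  length-positive-multiples g ks = trans (length-positives (map (_⋆ g) ks)) (length-map (_⋆ g) ks)

  signedSum-positive-multiples : ∀ g ks → signedSum G (positives (map (_⋆ g) ks)) ≡ sum ks ⋆ g
  signedSum-positive-multiples g []       = refl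
  signedSum-positive-multiples g (k ∷ ks) =
    trans (cong (k ⋆ g ⊕_) (signedSum-positive-multiples g ks)) (sym (⋆-homo-+ k (sum ks) g))

  harborth⇔zero-sum-free : ∀ {e} → IsPMHarborth G e (suc order) ⇔ (¬ HasPMZeroSum G e elements)
  harborth⇔zero-sum-free = mk⇔
    (λ (_ , below-minimal) zero-sum → below-minimal order (n<1+n order) λ S S-unique order≤|S| →
       zero-sum-⊆ (λ {x} _ → unique∧order≤length⇒∈ S-unique order≤|S| x) zero-sum)
    (λ zero-sum-free →
       (λ S S-unique 1+order≤|S| → contradiction (unique⇒length≤order S-unique) (<⇒≱ 1+order≤|S|)) ,
       (λ m m<1+order has-property → zero-sum-free
          (has-property elements elements-unique (subst (m ≤_) (sym length-elements) (s≤s⁻¹ m<1+order)))))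

  HasOrder : Carrier → ℕ → Set
  HasOrder x m = 0 < m × m ⋆ x ≡ 0# × (∀ k → k ⋆ x ≡ 0# → m ∣ k)

  infix 4 _∈⟨_⟩ _≼_
  _∈⟨_⟩ : Carrier → Carrier → Set
  x ∈⟨ g ⟩ = ∃ λ k → k ⋆ g ≡ x

  ∈⟨⟩-⊕ : ∀ {g x y} → x ∈⟨ g ⟩ → y ∈⟨ g ⟩ → x ⊕ y ∈⟨ g ⟩
  ∈⟨⟩-⊕ {g} (i , refl) (j , refl) = i + j , ⋆-homo-+ i j g

  -- the order of a divides the order of c
  _≼_ : Carrier → Carrier → Set
  a ≼ c = ∀ k → k ⋆ c ≡ 0# → k ⋆ a ≡ 0#

  ≼-trans : ∀ {a b c} → a ≼ b → b ≼ c → a ≼ c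
  ≼-trans a≼b b≼c k k⋆c≡0 = a≼b k (b≼c k k⋆c≡0)

  ≡⊖⇒⊕≡0 : ∀ {x} → x ≡ ⊖ x → x ⊕ x ≡ 0#
  ≡⊖⇒⊕≡0 {x} x≡⊖x = trans (cong (x ⊕_) x≡⊖x) (inverseʳ x)

  ⊖≡⋆ : ∀ {m x} → 0 < m → m ⋆ x ≡ 0# → ⊖ x ≡ (m ∸ 1) ⋆ x
  ⊖≡⋆ {m} {x} 0<m m⋆x≡0 = sym (inverseʳ-unique x ((m ∸ 1) ⋆ x) (trans (cong (_⋆ x) (m+[n∸m]≡n 0<m)) m⋆x≡0))

  ⋆-order : ∀ {a m m′} → HasOrder a m → (m′∣m : m′ ∣ m) → HasOrder (quotient m′∣m ⋆ a) m′
  ⋆-order {a} {m} {m′} (0<m , m⋆a≡0 , m∣) (divides u m≡um′) =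
    >-nonZero⁻¹ m′ , m′⋆u⋆a≡0 ,
    λ k k⋆u⋆a≡0 → *-cancelʳ-∣ u (subst (_∣ k * u) m≡m′u (m∣ (k * u) (trans (⋆-homo-* k u a) k⋆u⋆a≡0)))
    where
    instance
      um′≢0 : NonZero (u * m′)
      um′≢0 = subst NonZero m≡um′ (>-nonZero 0<m)
      u≢0 = m*n≢0⇒m≢0 u
      m′≢0 = m*n≢0⇒n≢0 u
    m≡m′u : m ≡ m′ * u
    m≡m′u = trans m≡um′ (*-comm u m′)
    m′⋆u⋆a≡0 : m′ ⋆ u ⋆ a ≡ 0#
    m′⋆u⋆a≡0 = trans (sym (⋆-homo-* m′ u a)) (trans (cong (_⋆ a) (sym m≡m′u)) m⋆a≡0)

  module _ {g m} (g-order : HasOrder g m) where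
    private
      instance
        m≢0 : NonZero m
        m≢0 = >-nonZero (proj₁ g-order)
      m⋆g≡0 : m ⋆ g ≡ 0#
      m⋆g≡0 = proj₁ (proj₂ g-order)

    ⋆-injective-≤ : ∀ {a b} → a ≤ b → b < m → a ⋆ g ≡ b ⋆ g → a ≡ b
    ⋆-injective-≤ {a} {b} a≤b b<m a⋆g≡b⋆g = ≤-antisym a≤b (m∸n≡0⇒m≤n b∸a≡0)
      where
      open ≡-Reasoning
      [b∸a]⋆g≡0 : (b ∸ a) ⋆ g ≡ 0#
      [b∸a]⋆g≡0 = ∙-cancelˡ (a ⋆ g) _ _ (begin
        a ⋆ g ⊕ (b ∸ a) ⋆ g  ≡⟨ ⋆-homo-+ a (b ∸ a) g ⟨
        (a + (b ∸ a)) ⋆ g    ≡⟨ cong (_⋆ g) (m+[n∸m]≡n a≤b) ⟩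
        b ⋆ g                ≡⟨ a⋆g≡b⋆g ⟨
        a ⋆ g                ≡⟨ identityʳ (a ⋆ g) ⟨
        a ⋆ g ⊕ 0#           ∎)
      b∸a≡0 : b ∸ a ≡ 0
      b∸a≡0 with b ∸ a ≟ 0
      ... | yes b∸a≡0 = b∸a≡0
      ... | no  b∸a≢0 = contradiction (∣⇒≤ {{≢-nonZero b∸a≢0}} (proj₂ (proj₂ g-order) (b ∸ a) [b∸a]⋆g≡0))
                                      (<⇒≱ (≤-<-trans (m∸n≤m b a) b<m))

    ⋆-injective : ∀ {a b} → a < m → b < m → a ⋆ g ≡ b ⋆ g → a ≡ b
    ⋆-injective {a} {b} a<m b<m a⋆g≡b⋆g with ≤-total a b
    ... | inj₁ a≤b = ⋆-injective-≤ a≤b b<m a⋆g≡b⋆g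
    ... | inj₂ b≤a = sym (⋆-injective-≤ b≤a a<m (sym a⋆g≡b⋆g))

    ⋆≡⇒%≡ : ∀ {a b} → a ⋆ g ≡ b ⋆ g → a % m ≡ b % m
    ⋆≡⇒%≡ {a} {b} a⋆g≡b⋆g =
      ⋆-injective (m%n<n a m) (m%n<n b m) (trans (sym (⋆-% m⋆g≡0 a)) (trans a⋆g≡b⋆g (⋆-% m⋆g≡0 b)))

    multiples-unique : ∀ {ks} → Unique ks → All (_< m) ks → Unique (map (_⋆ g) ks)
    multiples-unique [] [] = []
    multiples-unique (k∉ks ∷ ks-unique) (k<m ∷ ks<m) =
      All.map⁺ (All.zipWith (λ (k≢j , j<m) → k≢j ∘ ⋆-injective k<m j<m) (k∉ks , ks<m))
      ∷ multiples-unique ks-unique ks<m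

    multiples : List Carrier
    multiples = map (_⋆ g) (interval 0 m)

    length-multiples : length multiples ≡ m
    length-multiples = trans (length-map (_⋆ g) (interval 0 m)) (length-iterate suc 0 m)

    all-multiples-unique : Unique multiples
    all-multiples-unique = multiples-unique (interval-unique 0 m) (interval-< 0 m)

    ∈-multiples : ∀ {x} → x ∈⟨ g ⟩ → x ∈ multiples
    ∈-multiples (k , refl) =
      subst (_∈ multiples) (sym (⋆-% m⋆g≡0 k)) (∈-map⁺ (_⋆ g) (∈-interval⁺ 0 m z≤n (m%n<n k m)))

    ∈⟨⟩? : ∀ x → Dec (x ∈⟨ g ⟩)
    ∈⟨⟩? x = map′ (λ x∈ → let k , _ , x≡k⋆g = ∈-map⁻ (_⋆ g) x∈ in k , sym x≡k⋆g) ∈-multiples (x ∈? multiples)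

    generator⇒order≡ : (∀ x → x ∈⟨ g ⟩) → order ≡ m
    generator⇒order≡ generates = ≤-antisym
      (subst₂ _≤_ length-elements length-multiples
        (unique∧⊆⇒length≤ _≟ᴳ_ elements-unique (λ {x} _ → ∈-multiples (generates x))))
      (subst (_≤ order) length-multiples (unique⇒length≤order all-multiples-unique))

  odd-order⇒zero-sum : ∀ {g} q → HasOrder g (1 + q * 2) → HasPMZeroSum G (1 + q * 2) elements
  odd-order⇒zero-sum {g} q g-order@(_ , n⋆g≡0 , _) =
    distinct-zero-sum (positives (multiples g-order))
      (trans (length-positives (multiples g-order)) (length-multiples g-order))
      (subst Unique (sym (proj₂-positives _)) (all-multiples-unique g-order))
      (begin
        signedSum G (positives (multiples g-order))  ≡⟨ signedSum-positive-multiples g (interval 0 n) ⟩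
        sum (interval 0 n) ⋆ g                      ≡⟨ cong (_⋆ g) (sum-interval-odd q) ⟩
        (q * n) ⋆ g                                 ≡⟨ ∣-annihilates n⋆g≡0 (n∣m*n q) ⟩
        0#                                          ∎)
    where
    open ≡-Reasoning
    n = 1 + q * 2

  -- All of ⟨g⟩ with the sign of Q · g flipped: the flip subtracts 2Q · g = (n/2) · g,
  -- which is what the full sum n(n − 1)/2 · g amounts to when 4 ∣ n.
  0mod4-order⇒zero-sum : ∀ {g} q → HasOrder g (suc q * 4) → HasPMZeroSum G (suc q * 4) elements
  0mod4-order⇒zero-sum {g} q g-order@(_ , n⋆g≡0 , _) = distinct-zero-sum ts length≡n distinct sum≡0
    where
    open ≡-Reasoning
    n = suc q * 4
    Q = suc q
    ks = punctured 0 Q (2 + 3 * q)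
    ts = (false , Q ⋆ g) ∷ positives (map (_⋆ g) ks)
    n≡ : ∀ q → suc q + suc (2 + 3 * q) ≡ suc q * 4
    n≡ = solve-∀
    Q<n : Q < n
    Q<n = subst (Q <_) (n≡ q) (m<m+n Q z<s)
    ks<n : All (_< n) ks
    ks<n = All.tabulate λ {k} k∈ → subst (k <_) (n≡ q) (proj₁ (∈-punctured⁻ 0 Q (2 + 3 * q) k∈))
    Q∉ks : All (Q ≢_) ks
    Q∉ks = All.tabulate λ k∈ → proj₂ (∈-punctured⁻ 0 Q (2 + 3 * q) k∈) ∘ sym
    length≡n : length ts ≡ n
    length≡n = trans (cong suc (trans (length-positive-multiples g ks) (length-punctured 0 Q (2 + 3 * q))))
                     (trans (sym (+-suc Q (2 + 3 * q))) (n≡ q))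
    distinct : Unique (map proj₂ ts)
    distinct = subst (λ ys → Unique (Q ⋆ g ∷ ys)) (sym (proj₂-positives _))
                     (multiples-unique g-order (Q∉ks ∷ punctured-unique 0 Q (2 + 3 * q)) (Q<n ∷ ks<n))
    Σks≡Q : signedSum G (positives (map (_⋆ g) ks)) ≡ Q ⋆ g
    Σks≡Q = begin
      signedSum G (positives (map (_⋆ g) ks))  ≡⟨ signedSum-positive-multiples g ks ⟩
      sum ks ⋆ g                              ≡⟨ cong (_⋆ g) (sum-punctured-0mod4 q) ⟩
      (Q + (1 + 2 * q) * n) ⋆ g               ≡⟨ ⋆-+-multiple n⋆g≡0 Q (1 + 2 * q) ⟩
      Q ⋆ g                                   ∎
    sum≡0 : signedSum G ts ≡ 0#
    sum≡0 = trans (cong (⊖ (Q ⋆ g) ⊕_) Σks≡Q) (inverseˡ (Q ⋆ g))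

  -- ⟨g⟩ without 0 and without its element of order 2, completed by x and ⊖ x
  2mod4-order⇒zero-sum : ∀ {g x} q → HasOrder g (2 + suc q * 4) →
    ¬ x ∈⟨ g ⟩ → ¬ ⊖ x ∈⟨ g ⟩ → x ≢ ⊖ x → HasPMZeroSum G (2 + suc q * 4) elements
  2mod4-order⇒zero-sum {g} {x} q g-order@(_ , n⋆g≡0 , _) x∉⟨g⟩ ⊖x∉⟨g⟩ x≢⊖x =
    distinct-zero-sum (positives (x ∷ ⊖ x ∷ ys)) length≡n distinct sum≡0
    where
    open ≡-Reasoning
    n = 2 + suc q * 4
    m = 2 + 2 * q
    ks = punctured 1 m m
    ys = map (_⋆ g) ks
    n≡ : ∀ q → 1 + (2 + 2 * q) + suc (2 + 2 * q) ≡ 2 + suc q * 4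
    n≡ = solve-∀
    length≡n : length (positives (x ∷ ⊖ x ∷ ys)) ≡ n
    length≡n = trans (cong (suc ∘ suc) (trans (length-positive-multiples g ks) (length-punctured 1 m m)))
                     (trans (cong suc (sym (+-suc m m))) (n≡ q))
    outside : ∀ {y} → ¬ y ∈⟨ g ⟩ → All (y ≢_) ys
    outside y∉⟨g⟩ = All.map⁺ {xs = ks} {f = _⋆ g} (All.tabulate λ {k} _ y≡k⋆g → y∉⟨g⟩ (k , sym y≡k⋆g))
    distinct : Unique (map proj₂ (positives (x ∷ ⊖ x ∷ ys)))
    distinct = subst Unique (sym (proj₂-positives _))
      ((x≢⊖x ∷ outside x∉⟨g⟩) ∷ outside ⊖x∉⟨g⟩ ∷
       multiples-unique g-order (punctured-unique 1 m m)
         (All.tabulate λ {k} k∈ → subst (k <_) (n≡ q) (proj₁ (∈-punctured⁻ 1 m m k∈))))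
    Σys≡0 : signedSum G (positives ys) ≡ 0#
    Σys≡0 = begin
      signedSum G (positives ys)  ≡⟨ signedSum-positive-multiples g ks ⟩
      sum ks ⋆ g                  ≡⟨ cong (_⋆ g) (sum-punctured-2mod4 q) ⟩
      (m * n) ⋆ g                 ≡⟨ ∣-annihilates {n} n⋆g≡0 (n∣m*n m) ⟩
      0#                          ∎
    sum≡0 : signedSum G (positives (x ∷ ⊖ x ∷ ys)) ≡ 0#
    sum≡0 = begin
      x ⊕ (⊖ x ⊕ signedSum G (positives ys))  ≡⟨ cong (λ y → x ⊕ (⊖ x ⊕ y)) Σys≡0 ⟩
      x ⊕ (⊖ x ⊕ 0#)                          ≡⟨ cong (x ⊕_) (identityʳ (⊖ x)) ⟩
      x ⊕ ⊖ x                                 ≡⟨ inverseʳ x ⟩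
      0#                                      ∎

  module _ {e} (exponent : IsExponent G e) where
    private
      0<e : 0 < e
      0<e = proj₁ exponent
      e-annihilates : ∀ x → e ⋆ x ≡ 0#
      e-annihilates = proj₁ (proj₂ exponent)
      e-minimal : ∀ m → 0 < m → m < e → ¬ (∀ x → m ⋆ x ≡ 0#)
      e-minimal = proj₂ (proj₂ exponent)
      instance
        e≢0 : NonZero e
        e≢0 = >-nonZero 0<e

    order-exists : ∀ x → ∃ (HasOrder x)
    order-exists x with least-positive-or-none (λ k → k ⋆ x ≟ᴳ 0#) e
    ... | inj₂ none = contradiction (e-annihilates x) (none 0<e ≤-refl)
    ... | inj₁ (m , 0<m , m⋆x≡0 , below-m) = m , 0<m , m⋆x≡0 , m∣
      where
      instance
        m≢0 : NonZero m
        m≢0 = >-nonZero 0<m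
      m∣ : ∀ k → k ⋆ x ≡ 0# → m ∣ k
      m∣ k k⋆x≡0 with k % m ≟ 0
      ... | yes k%m≡0 = m%n≡0⇒n∣m k m k%m≡0
      ... | no  k%m≢0 = contradiction (trans (sym (⋆-% m⋆x≡0 k)) k⋆x≡0) (below-m (n≢0⇒n>0 k%m≢0) (m%n<n k m))

    coprime-annihilators⇒≡0 : ∀ {m n x} → Coprime m n → m ⋆ x ≡ 0# → n ⋆ x ≡ 0# → x ≡ 0#
    coprime-annihilators⇒≡0 {m} {n} {x} m⊥n m⋆x≡0 n⋆x≡0 with o , _ , o⋆x≡0 , o∣ ← order-exists x =
      trans (sym (identityʳ x)) (subst (λ o → o ⋆ x ≡ 0#) (m⊥n (o∣ m m⋆x≡0 , o∣ n n⋆x≡0)) o⋆x≡0)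

    coprime-⊕-annihilator : ∀ {m n a b} k → Coprime m n → m ⋆ a ≡ 0# → n ⋆ b ≡ 0# →
      k ⋆ (a ⊕ b) ≡ 0# → k ⋆ a ≡ 0#
    coprime-⊕-annihilator {m} {n} {a} {b} k m⊥n m⋆a≡0 n⋆b≡0 k⋆[a⊕b]≡0 =
      coprime-annihilators⇒≡0 m⊥n (⋆-annihilates {m} {a} k m⋆a≡0) (begin
        n ⋆ k ⋆ a                 ≡⟨ identityʳ _ ⟨
        n ⋆ k ⋆ a ⊕ 0#            ≡⟨ cong (n ⋆ k ⋆ a ⊕_) (⋆-annihilates {n} {b} k n⋆b≡0) ⟨
        n ⋆ k ⋆ a ⊕ n ⋆ k ⋆ b     ≡⟨ ⋆-distrib-⊕ n (k ⋆ a) (k ⋆ b) ⟨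
        n ⋆ (k ⋆ a ⊕ k ⋆ b)       ≡⟨ cong (n ⋆_) (⋆-distrib-⊕ k a b) ⟨
        n ⋆ k ⋆ (a ⊕ b)           ≡⟨ cong (n ⋆_) k⋆[a⊕b]≡0 ⟩
        n ⋆ 0#                    ≡⟨ ⋆-zeroʳ n ⟩
        0#                        ∎)
      where open ≡-Reasoning

    coprime-orders-⊕ : ∀ {a b m n} → HasOrder a m → HasOrder b n → Coprime m n →
      ∀ k → k ⋆ (a ⊕ b) ≡ 0# → m * n ∣ k
    coprime-orders-⊕ {a} {b} (_ , m⋆a≡0 , m∣) (_ , n⋆b≡0 , n∣) m⊥n k k⋆[a⊕b]≡0 = coprime⇒*∣ m⊥n
      (m∣ k (coprime-⊕-annihilator k m⊥n m⋆a≡0 n⋆b≡0 k⋆[a⊕b]≡0))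
      (n∣ k (coprime-⊕-annihilator k (coprime-sym m⊥n) n⋆b≡0 m⋆a≡0
                                   (trans (cong (k ⋆_) (comm b a)) k⋆[a⊕b]≡0)))

    orders⇒≼-join : ∀ {a b m n} → HasOrder a m → HasOrder b n → ∃ λ c → a ≼ c × b ≼ c
    orders⇒≼-join {a} {b} {m} {n} a-order@(0<m , m⋆a≡0 , _) b-order@(_ , n⋆b≡0 , _) =
      from-factors (coprime-lcm-factors m n {{>-nonZero 0<m}})
      where
      from-factors : (∃₂ λ m′ n′ → m′ ∣ m × n′ ∣ n × Coprime m′ n′ × m ∣ m′ * n′ × n ∣ m′ * n′) →
                     ∃ λ c → a ≼ c × b ≼ c
      from-factors (m′ , n′ , m′∣m , n′∣n , m′⊥n′ , m∣m′n′ , n∣m′n′) =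
        c , (λ k k⋆c≡0 → ∣-annihilates m⋆a≡0 (∣-trans m∣m′n′ (m′n′∣ k k⋆c≡0)))
          , (λ k k⋆c≡0 → ∣-annihilates n⋆b≡0 (∣-trans n∣m′n′ (m′n′∣ k k⋆c≡0)))
        where
        c = quotient m′∣m ⋆ a ⊕ quotient n′∣n ⋆ b
        m′n′∣ : ∀ k → k ⋆ c ≡ 0# → m′ * n′ ∣ k
        m′n′∣ = coprime-orders-⊕ (⋆-order a-order m′∣m) (⋆-order b-order n′∣n) m′⊥n′

    ≼-join : ∀ a b → ∃ λ c → a ≼ c × b ≼ c
    ≼-join a b = orders⇒≼-join (proj₂ (order-exists a)) (proj₂ (order-exists b))

    ≼-upper-bound : ∀ xs → ∃ λ c → All (_≼ c) xs
    ≼-upper-bound []       = 0# , []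
    ≼-upper-bound (x ∷ xs) =
      let c , xs≼c      = ≼-upper-bound xs
          d , x≼d , c≼d = ≼-join x c
      in  d , x≼d ∷ All.map (λ y≼c → ≼-trans y≼c c≼d) xs≼c

    universal⇒order-exponent : ∀ {c} → (∀ x → x ≼ c) → HasOrder c e
    universal⇒order-exponent {c} x≼c = of-order (order-exists c)
      where
      of-order : ∃ (HasOrder c) → HasOrder c e
      of-order (o , c-order@(0<o , o⋆c≡0 , o∣)) = subst (HasOrder c) o≡e c-order
        where
        o≡e : o ≡ e
        o≡e = ≤-antisym (∣⇒≤ (o∣ e (e-annihilates c))) (≮⇒≥ λ o<e → e-minimal o 0<o o<e λ x → x≼c x o o⋆c≡0)

    exponent-attained : ∃ λ g → HasOrder g e
    exponent-attained =
      let c , all≼c = ≼-upper-bound elements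
      in  c , universal⇒order-exponent (λ x → All.lookup all≼c (∈-elements x))

    generator⇒order-exponent : ∀ {g} → (∀ x → x ∈⟨ g ⟩) → HasOrder g e
    generator⇒order-exponent {g} generates = universal⇒order-exponent λ x k k⋆g≡0 →
      let j , j⋆g≡x = generates x in subst (λ y → k ⋆ y ≡ 0#) j⋆g≡x (⋆-annihilates {k} {g} j k⋆g≡0)

    ∈⟨⟩-⊖ : ∀ {g x} → x ∈⟨ g ⟩ → ⊖ x ∈⟨ g ⟩
    ∈⟨⟩-⊖ {g} (j , refl) = (e ∸ 1) * j , trans (⋆-homo-* (e ∸ 1) j g) (sym (⊖≡⋆ 0<e (e-annihilates (j ⋆ g))))

    ⊖-outside : ∀ {g x} → ¬ x ∈⟨ g ⟩ → ¬ ⊖ x ∈⟨ g ⟩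
    ⊖-outside {x = x} x∉⟨g⟩ ⊖x∈⟨g⟩ = x∉⟨g⟩ (subst (_∈⟨ _ ⟩) (⁻¹-involutive x) (∈⟨⟩-⊖ ⊖x∈⟨g⟩))

    -- if h is not an involution take h, otherwise h ⊕ g, whose double is 2 · g ≢ 0
    non-involution-outside : ∀ {g h} → HasOrder g e → 2 < e → ¬ h ∈⟨ g ⟩ →
      ∃ λ x → ¬ x ∈⟨ g ⟩ × ¬ ⊖ x ∈⟨ g ⟩ × x ≢ ⊖ x
    non-involution-outside {g} {h} (_ , _ , e∣) 2<e h∉⟨g⟩ with h ⊕ h ≟ᴳ 0#
    ... | no  h⊕h≢0 = h , h∉⟨g⟩ , ⊖-outside h∉⟨g⟩ , h⊕h≢0 ∘ ≡⊖⇒⊕≡0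
    ... | yes h⊕h≡0 = h ⊕ g , h⊕g∉⟨g⟩ , ⊖-outside h⊕g∉⟨g⟩ , 2⋆g≢0 ∘ double≡2⋆g ∘ ≡⊖⇒⊕≡0
      where
      open ≡-Reasoning
      h⊕g∉⟨g⟩ : ¬ h ⊕ g ∈⟨ g ⟩
      h⊕g∉⟨g⟩ h⊕g∈⟨g⟩ = h∉⟨g⟩ (subst (_∈⟨ g ⟩) h⊕g⊖g≡h (∈⟨⟩-⊕ h⊕g∈⟨g⟩ (∈⟨⟩-⊖ (1 , identityʳ g))))
        where
        h⊕g⊖g≡h : h ⊕ g ⊕ ⊖ g ≡ h
        h⊕g⊖g≡h = trans (assoc h g (⊖ g)) (trans (cong (h ⊕_) (inverseʳ g)) (identityʳ h))
      2⋆g≢0 : 2 ⋆ g ≢ 0#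
      2⋆g≢0 2⋆g≡0 = <⇒≱ 2<e (∣⇒≤ (e∣ 2 2⋆g≡0))
      double≡2⋆g : h ⊕ g ⊕ (h ⊕ g) ≡ 0# → 2 ⋆ g ≡ 0#
      double≡2⋆g double≡0 = begin
        g ⊕ (g ⊕ 0#)         ≡⟨ cong (g ⊕_) (identityʳ g) ⟩
        g ⊕ g                ≡⟨ identityˡ (g ⊕ g) ⟨
        0# ⊕ (g ⊕ g)         ≡⟨ cong (_⊕ (g ⊕ g)) h⊕h≡0 ⟨
        h ⊕ h ⊕ (g ⊕ g)      ≡⟨ interchange h g h g ⟨
        h ⊕ g ⊕ (h ⊕ g)      ≡⟨ double≡0 ⟩
        0#                   ∎

  elementary⇒zero-sum-free : IsElementary2Group G → ¬ HasPMZeroSum G 2 elements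
  elementary⇒zero-sum-free (_ , 2-annihilates , _)
    ((s , a) ∷ (t , b) ∷ [] , refl , (a≢b ∷ []) ∷ _ , _ , sum≡0) = a≢b a≡b
    where
    ⊖≡id : ∀ x → ⊖ x ≡ x
    ⊖≡id x = sym (inverseʳ-unique x x (trans (cong (x ⊕_) (sym (identityʳ x))) (2-annihilates x)))
    signedSum-∷ : ∀ s x ts → signedSum G ((s , x) ∷ ts) ≡ x ⊕ signedSum G ts
    signedSum-∷ true  x ts = refl
    signedSum-∷ false x ts = cong (_⊕ signedSum G ts) (⊖≡id x)
    a⊕b≡0 : a ⊕ b ≡ 0#
    a⊕b≡0 = begin
      a ⊕ b                       ≡⟨ cong (a ⊕_) (identityʳ b) ⟨
      a ⊕ (b ⊕ 0#)                ≡⟨ cong (a ⊕_) (signedSum-∷ t b []) ⟨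
      a ⊕ signedSum G ((t , b) ∷ [])  ≡⟨ signedSum-∷ s a _ ⟨
      signedSum G ((s , a) ∷ (t , b) ∷ [])  ≡⟨ sum≡0 ⟩
      0#                          ∎
      where open ≡-Reasoning
    a≡b : a ≡ b
    a≡b = trans (sym (⊖≡id a)) (sym (inverseʳ-unique a b a⊕b≡0))

  module _ {g} q (g-order : HasOrder g (2 + q * 4)) (generates : ∀ x → x ∈⟨ g ⟩) where
    private
      n = 2 + q * 4
      H = 1 + q * 2
      n≡H*2 : n ≡ H * 2
      n≡H*2 = cong (2 +_) (sym (*-assoc q 2 2))
      2∣n : 2 ∣ n
      2∣n = divides H n≡H*2
      n⋆g≡0 : n ⋆ g ≡ 0#
      n⋆g≡0 = proj₁ (proj₂ g-order)

    -- independent of the chosen index because the order of g is even (see parity-⋆)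
    parity : Carrier → ℕ
    parity x = proj₁ (generates x) % 2

    parity≤1 : ∀ x → parity x ≤ 1
    parity≤1 x = s≤s⁻¹ (m%n<n (proj₁ (generates x)) 2)

    parity-⋆ : ∀ k → parity (k ⋆ g) ≡ k % 2
    parity-⋆ k = begin
      j % 2      ≡⟨ m∣n⇒o%n%m≡o%m 2 n j 2∣n ⟨
      j % n % 2  ≡⟨ cong (_% 2) (⋆≡⇒%≡ g-order {j} {k} (proj₂ (generates (k ⋆ g)))) ⟩
      k % n % 2  ≡⟨ m∣n⇒o%n%m≡o%m 2 n k 2∣n ⟩
      k % 2      ∎
      where
      open ≡-Reasoning
      j = proj₁ (generates (k ⋆ g))

    parity-⊕ : ∀ x y → parity (x ⊕ y) ≡ (parity x + parity y) % 2
    parity-⊕ x y with i , refl ← generates x | j , refl ← generates y = begin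
      parity (i ⋆ g ⊕ j ⋆ g)              ≡⟨ cong parity (⋆-homo-+ i j g) ⟨
      parity ((i + j) ⋆ g)                ≡⟨ parity-⋆ (i + j) ⟩
      (i + j) % 2                         ≡⟨ %-distribˡ-+ i j 2 ⟩
      (i % 2 + j % 2) % 2                 ∎
      where open ≡-Reasoning

    parity-⊖ : ∀ x → parity (⊖ x) ≡ parity x
    parity-⊖ x = sym (bits-even-sum⇒≡ (parity≤1 x) (parity≤1 (⊖ x))
      (trans (sym (parity-⊕ x (⊖ x))) (trans (cong parity (inverseʳ x)) (parity-⋆ 0))))

    parity-signedSum : ∀ ts → parity (signedSum G ts) ≡ sum (map parity (map proj₂ ts)) % 2
    parity-signedSum [] = parity-⋆ 0
    parity-signedSum ((true , y) ∷ ts) =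
      trans (parity-⊕ y _) (trans (cong (λ p → (parity y + p) % 2) (parity-signedSum ts))
                                  ([m+n%d]%d≡[m+n]%d (parity y) _ 2))
    parity-signedSum ((false , y) ∷ ts) =
      trans (parity-⊕ (⊖ y) _) (trans (cong₂ (λ a p → (a + p) % 2) (parity-⊖ y) (parity-signedSum ts))
                                     ([m+n%d]%d≡[m+n]%d (parity y) _ 2))

    same-parity : ℕ → List Carrier
    same-parity b = map (λ j → (b + j * 2) ⋆ g) (interval 0 H)

    ∈-same-parity : ∀ x → x ∈ same-parity (parity x)
    ∈-same-parity x = subst (_∈ same-parity (parity x)) [p+r/2*2]⋆g≡x
      (∈-map⁺ (λ j → (parity x + j * 2) ⋆ g) (∈-interval⁺ 0 H z≤n r/2<H))
      where
      k = proj₁ (generates x)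
      r = k % n
      r≡ : r ≡ parity x + r / 2 * 2
      r≡ = trans (m≡m%n+[m/n]*n r 2) (cong (_+ r / 2 * 2) (m∣n⇒o%n%m≡o%m 2 n k 2∣n))
      [p+r/2*2]⋆g≡x : (parity x + r / 2 * 2) ⋆ g ≡ x
      [p+r/2*2]⋆g≡x = trans (cong (_⋆ g) (sym r≡)) (trans (sym (⋆-% n⋆g≡0 k)) (proj₂ (generates x)))
      r/2<H : r / 2 < H
      r/2<H = *-cancelʳ-< 2 (r / 2) H
        (≤-<-trans (m≤n+m (r / 2 * 2) (parity x)) (subst₂ _<_ r≡ n≡H*2 (m%n<n k n)))

    parity-class-bound : ∀ {P : Carrier → Set} (P? : ∀ x → Dec (P x)) b →
      (∀ {x} → P x → parity x ≡ b) → ∀ {ys} → Unique ys → length (filter P? ys) ≤ H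
    parity-class-bound P? b P⇒parity≡b {ys} ys-unique =
      subst (length (filter P? ys) ≤_) (trans (length-map _ (interval 0 H)) (length-iterate suc 0 H))
        (unique∧⊆⇒length≤ _≟ᴳ_ (Unique.filter⁺ P? ys-unique) λ {x} x∈ →
          subst (λ c → x ∈ same-parity c) (P⇒parity≡b (proj₂ (∈-filter⁻ P? {xs = ys} x∈)))
                (∈-same-parity x))

    odd-count : ∀ {ys} → Unique ys → length ys ≡ n → length (filter (λ y → parity y ≟ 1) ys) ≡ H
    odd-count {ys} ys-unique length≡n = ≤-antisym odd≤H (+-cancelʳ-≤ H H _ (begin
      H + H          ≡⟨ H+H≡n q ⟩
      n              ≡⟨ length≡n ⟨
      length ys      ≡⟨ length-filter-+-∁ odd? ys ⟨
      #odd + #even   ≤⟨ +-monoʳ-≤ #odd even≤H ⟩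
      #odd + H       ∎))
      where
      open ≤-Reasoning
      odd? = λ y → parity y ≟ 1
      #odd = length (filter odd? ys)
      #even = length (filter (¬? ∘ odd?) ys)
      odd≤H = parity-class-bound odd? 1 id ys-unique
      even≤H = parity-class-bound (¬? ∘ odd?) 0 (λ {x} → bit≢1⇒≡0 (parity≤1 x)) ys-unique
      H+H≡n : ∀ q → 1 + q * 2 + (1 + q * 2) ≡ 2 + q * 4
      H+H≡n = solve-∀

    cyclic⇒zero-sum-free : ¬ HasPMZeroSum G (2 + q * 4) elements
    cyclic⇒zero-sum-free (ts , length≡n , distinct , _ , sum≡0) = 0≢1+n (begin
      0                                            ≡⟨ parity-⋆ 0 ⟨
      parity 0#                                    ≡⟨ cong parity sum≡0 ⟨
      parity (signedSum G ts)                      ≡⟨ parity-signedSum ts ⟩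
      sum (map parity ys) % 2                      ≡⟨ cong (_% 2) (sum-bits parity parity≤1 ys) ⟩
      length (filter (λ y → parity y ≟ 1) ys) % 2  ≡⟨ cong (_% 2) (odd-count distinct |ys|≡n) ⟩
      (1 + q * 2) % 2                              ≡⟨ [m+kn]%n≡m%n 1 q 2 ⟩
      1                                            ∎)
      where
      open ≡-Reasoning
      ys = map proj₂ ts
      |ys|≡n = trans (length-map proj₂ ts) length≡n

zero-sum-free⇒elementary-or-cyclic : ∀ G {e} → IsExponent G e → ¬ HasPMZeroSum G e (elements G) →
  IsElementary2Group G ⊎ IsCyclic2mod4 G
zero-sum-free⇒elementary-or-cyclic G {e} exponent zero-sum-free
  with mod4-view e | exponent-attained G exponent
... | odd q         | g , g-order = contradiction (odd-order⇒zero-sum G q g-order) zero-sum-free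
... | 0mod4 zero    | _           = contradiction (proj₁ exponent) λ ()
... | 0mod4 (suc q) | g , g-order = contradiction (0mod4-order⇒zero-sum G q g-order) zero-sum-free
... | 2mod4 zero    | _           = inj₁ exponent
... | 2mod4 (suc q) | g , g-order with all? (∈⟨⟩? G g-order) (elements G)
...   | yes all∈⟨g⟩ = inj₂ ((g , generates) , order%4≡2)
  where
  generates : ∀ x → _∈⟨_⟩ G x g
  generates x = All.lookup all∈⟨g⟩ (∈-elements G x)
  order%4≡2 : FiniteAbelianGroup.order G % 4 ≡ 2
  order%4≡2 = trans (cong (_% 4) (generator⇒order≡ G g-order generates)) ([m+kn]%n≡m%n 2 (suc q) 4)
...   | no ¬all∈⟨g⟩ =
  let h , h∉⟨g⟩ = Any.satisfied (All.¬All⇒Any¬ (∈⟨⟩? G g-order) (elements G) ¬all∈⟨g⟩)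
      x , x∉⟨g⟩ , ⊖x∉⟨g⟩ , x≢⊖x = non-involution-outside G exponent g-order (s≤s (s≤s (s≤s z≤n))) h∉⟨g⟩
  in  contradiction (2mod4-order⇒zero-sum G q g-order x∉⟨g⟩ ⊖x∉⟨g⟩ x≢⊖x) zero-sum-free

elementary-or-cyclic⇒zero-sum-free : ∀ G {e} → IsExponent G e → IsElementary2Group G ⊎ IsCyclic2mod4 G →
  ¬ HasPMZeroSum G e (elements G)
elementary-or-cyclic⇒zero-sum-free G exponent (inj₁ elementary) =
  elementary⇒zero-sum-free G elementary
  ∘ subst (λ n → HasPMZeroSum G n (elements G)) (exponent-unique G exponent elementary)
elementary-or-cyclic⇒zero-sum-free G {e} exponent (inj₂ ((g , generates) , order%4≡2)) =
  cyclic⇒zero-sum-free G q (subst (HasOrder G g) e≡2+q*4 g-order) generates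
  ∘ subst (λ n → HasPMZeroSum G n (elements G)) e≡2+q*4
  where
  open FiniteAbelianGroup G using (order)
  q = order / 4
  g-order = generator⇒order-exponent G exponent generates
  e≡2+q*4 : e ≡ 2 + q * 4
  e≡2+q*4 = trans (sym (generator⇒order≡ G g-order generates))
                  (trans (m≡m%n+[m/n]*n order 4) (cong (_+ q * 4) order%4≡2))

corollary4p1 : (G : FiniteAbelianGroup) (e : ℕ) → IsExponent G e →
    (IsPMHarborth G e (suc (FiniteAbelianGroup.order G)) → IsElementary2Group G ⊎ IsCyclic2mod4 G)
    × (IsElementary2Group G ⊎ IsCyclic2mod4 G → IsPMHarborth G e (suc (FiniteAbelianGroup.order G)))
corollary4p1 G e exponent =
  zero-sum-free⇒elementary-or-cyclic G exponent ∘ Equivalence.to (harborth⇔zero-sum-free G) ,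
  Equivalence.from (harborth⇔zero-sum-free G) ∘ elementary-or-cyclic⇒zero-sum-free G exponent
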